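{- Let $p$ be a propositional variable and $\alpha$ an atomic program. Then: (1) the sequent $p,[\alpha][\alpha^*]p\vdash[\alpha^*]p$ is not cut-free provable in $\mathtt{GTPDL}$; moreover it is not Fischer–Ladner-cut provable in $\mathtt{GTPDL}$; (2) $p,[\alpha][\alpha^*]p\vdash[\alpha^*]p$ is cut-free provable in $\mathtt{CGTPDL}$; (3) the sequent $p\vdash[\alpha]\overleftarrow{\langle\alpha\rangle}p$ is provable in $\mathtt{GTPDL}$ and in $\mathtt{CGTPDL}$; (4) $p\vdash[\alpha]\overleftarrow{\langle\alpha\rangle}p$ is cut-free provable neither in $\mathtt{GTPDL}$ nor in $\mathtt{CGTPDL}$.
   Context: $\mathtt{TPDL}$ formulae/programs: $\varphi ::= \bot \mid p \mid (\varphi\to\varphi) \mid [\pi]\varphi \mid \overleftarrow{[\pi]}\varphi$, $\pi ::= \alpha \mid \pi;\pi \mid \pi\cup\pi \mid \pi^{*} \mid \varphi?$; $\neg\varphi:=\varphi\to\bot$, $\overleftarrow{\langle\pi\rangle}\varphi:=\neg\overleftarrow{[\pi]}\neg\varphi$. Sequents are pairs of finite sets; commas denote union; $H\Gamma=\{H\varphi:\varphi\in\Gamma\}$. Common rules (premises $\Rightarrow$ conclusion; displayed compound formula in the conclusion is principal): (Ax) $\Rightarrow\Gamma\vdash\Delta$ if $\Gamma\cap\Delta\neq\emptyset$; ($\bot$) $\Rightarrow\Gamma,\bot\vdash\Delta$; ($\to$L) $\Gamma\vdash\varphi,\Delta$ and $\Gamma,\psi\vdash\Delta\Rightarrow\Gamma,\varphi\to\psi\vdash\Delta$;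 ($\to$R) $\Gamma,\varphi\vdash\psi,\Delta\Rightarrow\Gamma\vdash\varphi\to\psi,\Delta$; (Wk) $\Gamma\vdash\Delta\Rightarrow\Gamma'\vdash\Delta'$ for $\Gamma\subseteq\Gamma',\Delta\subseteq\Delta'$; (Cut) $\Gamma\vdash\varphi,\Delta$ and $\Gamma,\varphi\vdash\Delta\Rightarrow\Gamma\vdash\Delta$ ($\varphi$ is the cut formula); ($[\,]$) $\Gamma\vdash\varphi,\overleftarrow{[\pi]}\Delta\Rightarrow[\pi]\Gamma\vdash[\pi]\varphi,\Delta$; ($\overleftarrow{[\,]}$) $\Gamma\vdash\varphi,[\pi]\Delta\Rightarrow\overleftarrow{[\pi]}\Gamma\vdash\overleftarrow{[\pi]}\varphi,\Delta$; ($[;]$L) $\Gamma,[\pi_0][\pi_1]\varphi\vdash\Delta\Rightarrow\Gamma,[\pi_0;\pi_1]\varphi\vdash\Delta$; ($[;]$R) $\Gamma\vdash[\pi_0][\pi_1]\varphi,\Delta\Rightarrow\Gamma\vdash[\pi_0;\pi_1]\varphi,\Delta$; ($[\cup]$L) $\Gamma,[\pi_0]\varphi,[\pi_1]\varphi\vdash\Delta\Rightarrow\Gamma,[\pi_0\cup\pi_1]\varphi\vdash\Delta$; ($[\cup]$R) $\Gamma\vdash\Delta,[\pi_0]\varphi$ and $\Gamma\vdash\Delta,[\pi_1]\varphi\Rightarrow\Gamma\vdash[\pi_0\cup\pi_1]\varphi,\Delta$; ($[*]$L) $\Gamma,\varphi,[\pi][\pi^*]\varphi\vdash\Delta\Rightarrow\Gamma,[\pi^*]\varphi\vdash\Delta$;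 ($[?]$L) $\Gamma\vdash\varphi,\Delta$ and $\Gamma,\psi\vdash\Delta\Rightarrow\Gamma,[\varphi?]\psi\vdash\Delta$; ($[?]$R) $\Gamma,\varphi\vdash\psi,\Delta\Rightarrow\Gamma\vdash[\varphi?]\psi,\Delta$. $\mathtt{GTPDL}$: common rules plus ($[*]$R) $\Gamma,\varphi\vdash[\pi]\varphi\Rightarrow[\pi^*]\Gamma,\varphi\vdash[\pi^*]\varphi$; a $\mathtt{GTPDL}$ proof is a finite tree of sequents each node of which is the conclusion of a rule instance whose premises are exactly its children. $\mathtt{CGTPDL}$: common rules plus (C-s) $\Gamma\vdash\varphi,\Delta$ and $\Gamma\vdash[\pi][\pi^*]\varphi,\Delta\Rightarrow\Gamma\vdash[\pi^*]\varphi,\Delta$. A $\mathtt{CGTPDL}$ pre-proof is $(D,C)$: $D$ a finite tree of sequents each node being the conclusion of a rule instance with premises exactly its children or an unjustified leaf (bud); $C$ maps each bud to a companion, an inner node with the same sequent; the derivation graph identifies buds with companions. A path is a sequence of nodes $(\Gamma_i\vdash\Delta_i)$ each next a premise of the previous. A trace is $(\tau_i)$, $\tau_i\in\Delta_i$, with: at ($\to$R), principal $\varphi\to\psi\mapsto\psi$ or unchanged; at ($[\,]$), principal $[\pi]\varphi\mapsto\varphi$ (forced); at ($\overleftarrow{[\,]}$), principal $\overleftarrow{[\pi]}\varphi\mapsto\varphi$ (forced); at ($[;]$R), principal $\mapsto[\pi_0][\pi_1]\varphi$ or unchanged; at ($[\cup]$R) into the premise with $[\pi_j]\varphi$, principal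 $\mapsto[\pi_j]\varphi$ or unchanged; at ($[?]$R), principal $[\varphi?]\psi\mapsto\psi$ or unchanged; at (C-s) left premise, principal $[\pi^*]\varphi\mapsto\varphi$ or unchanged; at (C-s) right premise, principal $[\pi^*]\varphi\mapsto[\pi][\pi^*]\varphi$ (progress point) or unchanged; other rules, unchanged. A $\mathtt{CGTPDL}$ proof is a pre-proof in whose derivation graph every infinite path has a tail followed by a trace with infinitely many progress points. A proof is cut-free if it contains no instance of (Cut). Fischer–Ladner closure $\mathrm{FL}$: $\mathrm{FL}(\bot)=\{\bot\}$, $\mathrm{FL}(p)=\{p\}$, $\mathrm{FL}(\psi_0\to\psi_1)=\{\psi_0\to\psi_1\}\cup\mathrm{FL}(\psi_0)\cup\mathrm{FL}(\psi_1)$, $\mathrm{FL}([\pi]\psi)=\mathrm{FL}_\Box([\pi]\psi)\cup\mathrm{FL}(\psi)$, $\mathrm{FL}(\overleftarrow{[\pi]}\psi)=\mathrm{FL}_\Box(\overleftarrow{[\pi]}\psi)\cup\mathrm{FL}(\psi)$, with $\mathrm{FL}_\Box([\alpha]\psi)=\{[\alpha]\psi\}$, $\mathrm{FL}_\Box([\pi_0;\pi_1]\psi)=\{[\pi_0;\pi_1]\psi\}\cup\mathrm{FL}_\Box([\pi_0][\pi_1]\psi)\cup\mathrm{FL}_\Box([\pi_1]\psi)$, $\mathrm{FL}_\Box([\pi_0\cup\pi_1]\psi)=\{[\pi_0\cup\pi_1]\psi\}\cup\mathrm{FL}_\Box([\pi_0]\psi)\cup\mathrm{FL}_\Box([\pi_1]\psi)$,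 $\mathrm{FL}_\Box([\pi^*]\psi)=\{[\pi^*]\psi\}\cup\mathrm{FL}_\Box([\pi][\pi^*]\psi)$, $\mathrm{FL}_\Box([\psi_0?]\psi_1)=\{[\psi_0?]\psi_1\}\cup\mathrm{FL}(\psi_0)$, and symmetric clauses for $\overleftarrow{[\,]}$ except $\mathrm{FL}_\Box(\overleftarrow{[\pi_0;\pi_1]}\psi)=\{\overleftarrow{[\pi_0;\pi_1]}\psi\}\cup\mathrm{FL}_\Box(\overleftarrow{[\pi_1]}\overleftarrow{[\pi_0]}\psi)\cup\mathrm{FL}_\Box(\overleftarrow{[\pi_0]}\psi)$ and $\mathrm{FL}_\Box(\overleftarrow{[\pi^*]}\psi)=\{\overleftarrow{[\pi^*]}\psi\}\cup\mathrm{FL}_\Box(\overleftarrow{[\pi]}\overleftarrow{[\pi^*]}\psi)$; $\mathrm{FL}(\Lambda)=\bigcup_{\varphi\in\Lambda}\mathrm{FL}(\varphi)$. An instance of (Cut) with conclusion $\Gamma\vdash\Delta$ is a Fischer–Ladner cut if its cut formula lies in $\mathrm{FL}(\Gamma\cup\Delta)$. A sequent is Fischer–Ladner-cut provable in $\mathtt{GTPDL}$ if it has a $\mathtt{GTPDL}$ proof all of whose (Cut) instances are Fischer–Ladner cuts. -}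

module Defs where

open import Data.Nat using (ℕ; zero; suc; _+_; _≤_)
open import Data.List using (List; []; _∷_; _++_; map; [_]; _∷ʳ_)
open import Data.List.Membership.Propositional using (_∈_)
open import Data.List.Relation.Binary.Subset.Propositional using (_⊆_)
open import Data.List.Relation.Unary.All using (All; []; _∷_)
open import Data.Maybe using (Maybe; just; nothing)
open import Data.Product using (Σ; _×_; _,_; ∃)
open import Data.Sum using (_⊎_)
open import Data.Unit using (⊤)
open import Data.Empty using () renaming (⊥ to Empty)
open import Relation.Nullary using (¬_)
open import Relation.Binary.PropositionalEquality using (_≡_)

infixr 5 _⇒_

mutual
  data Fml : Set where
    ⊥'   : Fml
    var  : ℕ → Fml
    _⇒_  : Fml → Fml → Fml
    box  : Prog → Fml → Fml
    bbox : Prog → Fml → Fml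

  data Prog : Set where
    atom : ℕ → Prog
    _⨾_  : Prog → Prog → Prog
    _∪'_ : Prog → Prog → Prog
    star : Prog → Prog
    test : Fml → Prog

neg : Fml → Fml
neg φ = φ ⇒ ⊥'

bdia : Prog → Fml → Fml
bdia π φ = neg (bbox π (neg φ))

-- Sequents: pairs of finite sets, represented by lists and compared up
-- to set equality (same members).

infix 4 _⊢_
record Seq : Set where
  constructor _⊢_
  field
    ante : List Fml
    succ : List Fml
open Seq public

_≈set_ : List Fml → List Fml → Set
xs ≈set ys = ∀ x → (x ∈ xs → x ∈ ys) × (x ∈ ys → x ∈ xs)

_≅_ : Seq → Seq → Set
S ≅ T = (ante S ≈set ante T) × (succ S ≈set succ T)

mutual
  FL : Fml → List Fml
  FL ⊥'         = [ ⊥' ]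
  FL (var p)    = [ var p ]
  FL (φ ⇒ ψ)    = (φ ⇒ ψ) ∷ FL φ ++ FL ψ
  FL (box π ψ)  = FLbox π ψ ++ FL ψ
  FL (bbox π ψ) = FLbbox π ψ ++ FL ψ

  FLbox : Prog → Fml → List Fml
  FLbox (atom a)   ψ = [ box (atom a) ψ ]
  FLbox (π₀ ⨾ π₁)  ψ = box (π₀ ⨾ π₁) ψ ∷ FLbox π₀ (box π₁ ψ) ++ FLbox π₁ ψ
  FLbox (π₀ ∪' π₁) ψ = box (π₀ ∪' π₁) ψ ∷ FLbox π₀ ψ ++ FLbox π₁ ψ
  FLbox (star π)   ψ = box (star π) ψ ∷ FLbox π (box (star π) ψ)
  FLbox (test χ)   ψ = box (test χ) ψ ∷ FL χ

  FLbbox : Prog → Fml → List Fml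
  FLbbox (atom a)   ψ = [ bbox (atom a) ψ ]
  FLbbox (π₀ ⨾ π₁)  ψ = bbox (π₀ ⨾ π₁) ψ ∷ FLbbox π₁ (bbox π₀ ψ) ++ FLbbox π₀ ψ
  FLbbox (π₀ ∪' π₁) ψ = bbox (π₀ ∪' π₁) ψ ∷ FLbbox π₀ ψ ++ FLbbox π₁ ψ
  FLbbox (star π)   ψ = bbox (star π) ψ ∷ FLbbox π (bbox (star π) ψ)
  FLbbox (test χ)   ψ = bbox (test χ) ψ ∷ FL χ

FLs : List Fml → List Fml
FLs []       = []
FLs (φ ∷ Λ)  = FL φ ++ FLs Λ

-- Rule schemata.  Each schema determines a conclusion and a list of
-- premises; an instance at sequent S is a schema whose conclusion is
-- set-equal to S and whose side condition holds.

data Rule : Set where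
  ax     : (Γ Δ : List Fml) → Rule
  botL   : (Γ Δ : List Fml) → Rule
  impL   : (Γ Δ : List Fml) (φ ψ : Fml) → Rule
  impR   : (Γ Δ : List Fml) (φ ψ : Fml) → Rule
  wk     : (Γ Δ Γ' Δ' : List Fml) → Rule
  cut    : (Γ Δ : List Fml) (φ : Fml) → Rule
  boxR   : (Γ Δ : List Fml) (π : Prog) (φ : Fml) → Rule
  bboxR  : (Γ Δ : List Fml) (π : Prog) (φ : Fml) → Rule
  seqL   : (Γ Δ : List Fml) (π₀ π₁ : Prog) (φ : Fml) → Rule
  seqR   : (Γ Δ : List Fml) (π₀ π₁ : Prog) (φ : Fml) → Rule
  cupL   : (Γ Δ : List Fml) (π₀ π₁ : Prog) (φ : Fml) → Rule
  cupR   : (Γ Δ : List Fml) (π₀ π₁ : Prog) (φ : Fml) → Rule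
  starL  : (Γ Δ : List Fml) (π : Prog) (φ : Fml) → Rule
  testL  : (Γ Δ : List Fml) (φ ψ : Fml) → Rule
  testR  : (Γ Δ : List Fml) (φ ψ : Fml) → Rule
  starR  : (Γ : List Fml) (π : Prog) (φ : Fml) → Rule
  cs     : (Γ Δ : List Fml) (π : Prog) (φ : Fml) → Rule

concl : Rule → Seq
concl (ax Γ Δ)              = Γ ⊢ Δ
concl (botL Γ Δ)            = ⊥' ∷ Γ ⊢ Δ
concl (impL Γ Δ φ ψ)        = (φ ⇒ ψ) ∷ Γ ⊢ Δ
concl (impR Γ Δ φ ψ)        = Γ ⊢ (φ ⇒ ψ) ∷ Δ
concl (wk Γ Δ Γ' Δ')        = Γ' ⊢ Δ'
concl (cut Γ Δ φ)           = Γ ⊢ Δ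
concl (boxR Γ Δ π φ)        = map (box π) Γ ⊢ box π φ ∷ Δ
concl (bboxR Γ Δ π φ)       = map (bbox π) Γ ⊢ bbox π φ ∷ Δ
concl (seqL Γ Δ π₀ π₁ φ)    = box (π₀ ⨾ π₁) φ ∷ Γ ⊢ Δ
concl (seqR Γ Δ π₀ π₁ φ)    = Γ ⊢ box (π₀ ⨾ π₁) φ ∷ Δ
concl (cupL Γ Δ π₀ π₁ φ)    = box (π₀ ∪' π₁) φ ∷ Γ ⊢ Δ
concl (cupR Γ Δ π₀ π₁ φ)    = Γ ⊢ box (π₀ ∪' π₁) φ ∷ Δ
concl (starL Γ Δ π φ)       = box (star π) φ ∷ Γ ⊢ Δ
concl (testL Γ Δ φ ψ)       = box (test φ) ψ ∷ Γ ⊢ Δ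
concl (testR Γ Δ φ ψ)       = Γ ⊢ box (test φ) ψ ∷ Δ
concl (starR Γ π φ)         = φ ∷ map (box (star π)) Γ ⊢ [ box (star π) φ ]
concl (cs Γ Δ π φ)          = Γ ⊢ box (star π) φ ∷ Δ

prems : Rule → List Seq
prems (ax Γ Δ)              = []
prems (botL Γ Δ)            = []
prems (impL Γ Δ φ ψ)        = (Γ ⊢ φ ∷ Δ) ∷ (ψ ∷ Γ ⊢ Δ) ∷ []
prems (impR Γ Δ φ ψ)        = [ φ ∷ Γ ⊢ ψ ∷ Δ ]
prems (wk Γ Δ Γ' Δ')        = [ Γ ⊢ Δ ]
prems (cut Γ Δ φ)           = (Γ ⊢ φ ∷ Δ) ∷ (φ ∷ Γ ⊢ Δ) ∷ []
prems (boxR Γ Δ π φ)        = [ Γ ⊢ φ ∷ map (bbox π) Δ ]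
prems (bboxR Γ Δ π φ)       = [ Γ ⊢ φ ∷ map (box π) Δ ]
prems (seqL Γ Δ π₀ π₁ φ)    = [ box π₀ (box π₁ φ) ∷ Γ ⊢ Δ ]
prems (seqR Γ Δ π₀ π₁ φ)    = [ Γ ⊢ box π₀ (box π₁ φ) ∷ Δ ]
prems (cupL Γ Δ π₀ π₁ φ)    = [ box π₀ φ ∷ box π₁ φ ∷ Γ ⊢ Δ ]
prems (cupR Γ Δ π₀ π₁ φ)    = (Γ ⊢ box π₀ φ ∷ Δ) ∷ (Γ ⊢ box π₁ φ ∷ Δ) ∷ []
prems (starL Γ Δ π φ)       = [ φ ∷ box π (box (star π) φ) ∷ Γ ⊢ Δ ]
prems (testL Γ Δ φ ψ)       = (Γ ⊢ φ ∷ Δ) ∷ (ψ ∷ Γ ⊢ Δ) ∷ []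
prems (testR Γ Δ φ ψ)       = [ φ ∷ Γ ⊢ ψ ∷ Δ ]
prems (starR Γ π φ)         = [ φ ∷ Γ ⊢ [ box π φ ] ]
prems (cs Γ Δ π φ)          = (Γ ⊢ φ ∷ Δ) ∷ (Γ ⊢ box π (box (star π) φ) ∷ Δ) ∷ []

Side : Rule → Set
Side (ax Γ Δ)       = Σ Fml λ φ → φ ∈ Γ × φ ∈ Δ
Side (wk Γ Δ Γ' Δ') = (Γ ⊆ Γ') × (Δ ⊆ Δ')
Side _              = ⊤

InGTPDL : Rule → Set
InGTPDL (cs _ _ _ _) = Empty
InGTPDL _            = ⊤

InCGTPDL : Rule → Set
InCGTPDL (starR _ _ _) = Empty
InCGTPDL _             = ⊤

AnyCut : Rule → Set
AnyCut _ = ⊤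

CutFree : Rule → Set
CutFree (cut _ _ _) = Empty
CutFree _           = ⊤

FLCut : Rule → Set
FLCut (cut Γ Δ φ) = φ ∈ FLs (Γ ++ Δ)
FLCut _           = ⊤

-- GTPDL proofs: finite trees of rule instances.  `ok` restricts which
-- instances are allowed (used for cut restrictions).

data GProof (ok : Rule → Set) : Seq → Set where
  by : {S : Seq} (r : Rule) → InGTPDL r → ok r → Side r → S ≅ concl r →
       All (GProof ok) (prems r) → GProof ok S

GProvable : (Rule → Set) → Seq → Set
GProvable ok S = GProof ok S

-- CGTPDL pre-proofs: finite trees whose leaves may be buds.

data PTree (ok : Rule → Set) : Seq → Set where
  bud  : (S : Seq) → PTree ok S
  node : {S : Seq} (r : Rule) → InCGTPDL r → ok r → Side r → S ≅ concl r →
         All (PTree ok) (prems r) → PTree ok S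

-- node addresses: a list of premise indices from the root
Addr : Set
Addr = List ℕ

data Info : Set where
  budI   : Seq → Info
  innerI : Seq → Rule → Info

mutual
  infoAt : ∀ {ok S} → PTree ok S → Addr → Maybe Info
  infoAt (bud S)              []      = just (budI S)
  infoAt {S = S} (node r _ _ _ _ _) [] = just (innerI S r)
  infoAt (bud S)              (j ∷ a) = nothing
  infoAt (node r _ _ _ _ ts)  (j ∷ a) = infoAll ts j a

  infoAll : ∀ {ok Ss} → All (PTree ok) Ss → ℕ → Addr → Maybe Info
  infoAll []       j       a = nothing
  infoAll (t ∷ ts) zero    a = infoAt t a
  infoAll (t ∷ ts) (suc j) a = infoAll ts j a

record PreProof (ok : Rule → Set) (S : Seq) : Set where
  field
    tree   : PTree ok S
    comp   : Addr → Addr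
    compOK : ∀ a B → infoAt tree a ≡ just (budI B) →
             Σ Seq λ B' → Σ Rule λ r →
               (infoAt tree (comp a) ≡ just (innerI B' r)) × (B ≅ B')
open PreProof public

-- Edges of the derivation graph (vertices: inner nodes; buds identified
-- with their companions):  a --j--> b.
Edge : ∀ {ok S} → PreProof ok S → Addr → ℕ → Addr → Set
Edge P a j b =
  (Σ Seq λ S → Σ Rule λ r → infoAt (tree P) a ≡ just (innerI S r)) ×
  ( (Σ Seq λ B → infoAt (tree P) (a ∷ʳ j) ≡ just (budI B) × b ≡ comp P (a ∷ʳ j))
  ⊎ (Σ Seq λ S' → Σ Rule λ r' → infoAt (tree P) (a ∷ʳ j) ≡ just (innerI S' r') × b ≡ a ∷ʳ j))

record InfPath {ok S} (P : PreProof ok S) : Set where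
  field
    v    : ℕ → Addr
    js   : ℕ → ℕ
    edge : ∀ i → Edge P (v i) (js i) (v (suc i))
open InfPath public

-- trace steps: TStep r j τ τ' — τ (in the conclusion) continues as τ'
-- (in premise number j) across an instance of r.
TStep : Rule → ℕ → Fml → Fml → Set
TStep (impR Γ Δ φ ψ) 0 τ τ'       = τ' ≡ τ ⊎ (τ ≡ (φ ⇒ ψ) × τ' ≡ ψ)
TStep (boxR Γ Δ π φ) 0 τ τ'       = (τ ≡ box π φ × τ' ≡ φ) ⊎ (¬ τ ≡ box π φ × τ' ≡ τ)
TStep (bboxR Γ Δ π φ) 0 τ τ'      = (τ ≡ bbox π φ × τ' ≡ φ) ⊎ (¬ τ ≡ bbox π φ × τ' ≡ τ)
TStep (seqR Γ Δ π₀ π₁ φ) 0 τ τ'   = τ' ≡ τ ⊎ (τ ≡ box (π₀ ⨾ π₁) φ × τ' ≡ box π₀ (box π₁ φ))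
TStep (cupR Γ Δ π₀ π₁ φ) 0 τ τ'   = τ' ≡ τ ⊎ (τ ≡ box (π₀ ∪' π₁) φ × τ' ≡ box π₀ φ)
TStep (cupR Γ Δ π₀ π₁ φ) 1 τ τ'   = τ' ≡ τ ⊎ (τ ≡ box (π₀ ∪' π₁) φ × τ' ≡ box π₁ φ)
TStep (testR Γ Δ φ ψ) 0 τ τ'      = τ' ≡ τ ⊎ (τ ≡ box (test φ) ψ × τ' ≡ ψ)
TStep (cs Γ Δ π φ) 0 τ τ'         = τ' ≡ τ ⊎ (τ ≡ box (star π) φ × τ' ≡ φ)
TStep (cs Γ Δ π φ) 1 τ τ'         = τ' ≡ τ ⊎ (τ ≡ box (star π) φ × τ' ≡ box π (box (star π) φ))
TStep _ _ τ τ'                    = τ' ≡ τ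

Progress : Rule → ℕ → Fml → Fml → Set
Progress (cs Γ Δ π φ) 1 τ τ' = τ ≡ box (star π) φ × τ' ≡ box π (box (star π) φ)
Progress _ _ _ _             = Empty

record ProgressingTrace {ok S} {P : PreProof ok S} (p : InfPath P) (k : ℕ) : Set where
  field
    τ     : ℕ → Fml
    valid : ∀ i → Σ Seq λ Sᵢ → Σ Rule λ r →
              (infoAt (tree P) (v p (k + i)) ≡ just (innerI Sᵢ r)) ×
              (τ i ∈ succ Sᵢ) × TStep r (js p (k + i)) (τ i) (τ (suc i))
    prog  : ∀ n → Σ ℕ λ m → (n ≤ m) × (Σ Seq λ Sₘ → Σ Rule λ r →
              (infoAt (tree P) (v p (k + m)) ≡ just (innerI Sₘ r)) ×
              Progress r (js p (k + m)) (τ m) (τ (suc m)))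

IsCProof : ∀ {ok S} → PreProof ok S → Set
IsCProof P = (p : InfPath P) → Σ ℕ λ k → ProgressingTrace p k

CProvable : (Rule → Set) → Seq → Set
CProvable ok S = Σ (PreProof ok S) IsCProof

seq₁ : ℕ → ℕ → Seq
seq₁ p a = var p ∷ box (atom a) (box (star (atom a)) (var p)) ∷ [] ⊢ [ box (star (atom a)) (var p) ]

seq₂ : ℕ → ℕ → Seq
seq₂ p a = [ var p ] ⊢ [ box (atom a) (bdia (atom a) (var p)) ]

{-# OPTIONS --safe #-}
-- To refute provability we use a family of sequents closed backwards under the
-- permitted rules: every rule instance whose conclusion lies in the family has a
-- premise in it.  No finite proof then ends in the family, and in a CGTPDL
-- pre-proof one can follow premises and bud–companion links forever inside it;
-- if no member is the conclusion of (C-s), that infinite path meets no progress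
-- point.  Our families consist of sequents whose antecedent and succedent formulas
-- satisfy two predicates indexed by a finite set of "worlds".
--
-- For p, [α][α*]p ⊢ [α*]p, rule ([*]R) has to discard [α][α*]p, leaving the
-- unprovable p ⊢ [α]p, while ([ ]) discards the whole antecedent, after which only
-- boxed copies of p remain; a Fischer–Ladner cut cannot help because every formula
-- in the closure of a member is already placed on one side by its world.  For
-- p ⊢ [α]←⟨α⟩p the antecedent p is lost at the first ([ ]) unless a cut on ¬p first
-- moves it to the succedent, where ([ ]) turns it into ←[α]¬p.
--
-- The positive results are explicit finite derivations, and a pre-proof without
-- buds has no infinite path at all.

module Submission where

open import Defs
open import Data.Nat using (ℕ; zero; suc; _+_; _≤_; z≤n; s≤s; _⊔_)
open import Data.Nat.Properties using (≤-trans; ≤-reflexive; m≤m⊔n; m≤n⊔m; +-comm; 1+n≰n)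
open import Data.List using (List; []; _∷_; _++_; [_]; _∷ʳ_; length)
open import Data.List.Properties using (length-++)
open import Data.List.Membership.Propositional using (_∈_)
open import Data.List.Relation.Unary.All using (All; []; _∷_; lookup)
import Data.List.Relation.Unary.All as All
open import Data.List.Relation.Unary.All.Properties using (anti-mono; map⁺; map⁻; ++⁺)
open import Data.List.Relation.Unary.Any using (Any; here; there)
open import Data.Maybe using (Maybe; just; nothing)
import Data.Maybe as Maybe
open import Data.Product using (Σ; ∃; _×_; _,_; proj₁; proj₂)
open import Data.Sum using (_⊎_; inj₁; inj₂)
open import Data.Unit using (tt)
open import Data.Empty using (⊥-elim)
open import Function using (id; _∘_)
open import Relation.Nullary using (¬_)
open import Relation.Unary using (_∩_)
open import Relation.Binary.PropositionalEquality using (_≡_; refl; sym; trans; cong; subst)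

≅-refl : ∀ {S} → S ≅ S
≅-refl = (λ _ → id , id) , (λ _ → id , id)

GTPDL CGTPDL : (Rule → Set) → Rule → Set
GTPDL ok  = InGTPDL ∩ ok
CGTPDL ok = InCGTPDL ∩ ok

InBoth : Rule → Set
InBoth = InGTPDL ∩ InCGTPDL

OnlyFLCuts : (Rule → Set) → Set
OnlyFLCuts ok = ∀ {Γ Δ φ} → ok (cut Γ Δ φ) → φ ∈ FLs (Γ ++ Δ)

length-∷ʳ : ∀ (xs : Addr) j → length (xs ∷ʳ j) ≡ suc (length xs)
length-∷ʳ xs j = trans (length-++ xs) (+-comm (length xs) 1)

data Derivation (allowed : Rule → Set) : Seq → Set where
  by : ∀ {S} r → allowed r → Side r → S ≅ concl r →
       All (Derivation allowed) (prems r) → Derivation allowed S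

module _ {allowed ok : Rule → Set} where

  derivation⇒GProof : (∀ {r} → allowed r → GTPDL ok r) →
                      ∀ {S} → Derivation allowed S → GProof ok S
  derivation⇒GProof allowed⇒G = toG
    where
    mutual
      toG : ∀ {S} → Derivation allowed S → GProof ok S
      toG (by r a s e ds) = by r (proj₁ (allowed⇒G a)) (proj₂ (allowed⇒G a)) s e (toGs ds)

      toGs : ∀ {Ss} → All (Derivation allowed) Ss → All (GProof ok) Ss
      toGs []       = []
      toGs (d ∷ ds) = toG d ∷ toGs ds

  mutual
    height : ∀ {S} → Derivation allowed S → ℕ
    height (by _ _ _ _ ds) = suc (heights ds)

    heights : ∀ {Ss} → All (Derivation allowed) Ss → ℕ
    heights []       = 0
    heights (d ∷ ds) = height d ⊔ heights ds

  module _ (allowed⇒C : ∀ {r} → allowed r → CGTPDL ok r) where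

    mutual
      toPTree : ∀ {S} → Derivation allowed S → PTree ok S
      toPTree (by r a s e ds) = node r (proj₁ (allowed⇒C a)) (proj₂ (allowed⇒C a)) s e (toPTrees ds)

      toPTrees : ∀ {Ss} → All (Derivation allowed) Ss → All (PTree ok) Ss
      toPTrees []       = []
      toPTrees (d ∷ ds) = toPTree d ∷ toPTrees ds

    mutual
      toPTree-budFree : ∀ {S} (d : Derivation allowed S) a {B} →
                        ¬ infoAt (toPTree d) a ≡ just (budI B)
      toPTree-budFree (by _ _ _ _ ds) (j ∷ a) = toPTrees-budFree ds j a

      toPTrees-budFree : ∀ {Ss} (ds : All (Derivation allowed) Ss) j a {B} →
                         ¬ infoAll (toPTrees ds) j a ≡ just (budI B)
      toPTrees-budFree (d ∷ ds) zero    a = toPTree-budFree d a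
      toPTrees-budFree (d ∷ ds) (suc j) a = toPTrees-budFree ds j a

    mutual
      toPTree-depth : ∀ {S} (d : Derivation allowed S) a {x} →
                      infoAt (toPTree d) a ≡ just x → length a ≤ height d
      toPTree-depth d               []      _ = z≤n
      toPTree-depth (by _ _ _ _ ds) (j ∷ a) e = s≤s (toPTrees-depth ds j a e)

      toPTrees-depth : ∀ {Ss} (ds : All (Derivation allowed) Ss) j a {x} →
                       infoAll (toPTrees ds) j a ≡ just x → length a ≤ heights ds
      toPTrees-depth (d ∷ ds) zero    a e = ≤-trans (toPTree-depth d a e) (m≤m⊔n _ _)
      toPTrees-depth (d ∷ ds) (suc j) a e = ≤-trans (toPTrees-depth ds j a e) (m≤n⊔m _ _)

    toPreProof : ∀ {S} → Derivation allowed S → PreProof ok S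
    toPreProof d = record
      { tree   = toPTree d
      ; comp   = id
      ; compOK = λ a B e → ⊥-elim (toPTree-budFree d a e)
      }

    toPreProof-¬InfPath : ∀ {S} (d : Derivation allowed S) → ¬ InfPath (toPreProof d)
    toPreProof-¬InfPath d path = 1+n≰n (≤-trans (deepens (suc (height d))) (bounded (suc (height d))))
      where
      bounded : ∀ k → length (v path k) ≤ height d
      bounded k = toPTree-depth d (v path k) (proj₂ (proj₂ (proj₁ (edge path k))))

      deepens : ∀ k → k ≤ length (v path k)
      deepens zero    = z≤n
      deepens (suc k) with edge path k
      ... | _ , inj₁ (_ , isBud , _)   = ⊥-elim (toPTree-budFree d _ isBud)
      ... | _ , inj₂ (_ , _ , _ , eq) =
        ≤-trans (s≤s (deepens k)) (≤-reflexive (sym (trans (cong length eq) (length-∷ʳ (v path k) (js path k)))))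

    derivation⇒CProvable : ∀ {S} → Derivation allowed S → CProvable ok S
    derivation⇒CProvable d = toPreProof d , ⊥-elim ∘ toPreProof-¬InfPath d

BackwardClosed : (Rule → Set) → (Seq → Set) → Set
BackwardClosed allowed I =
  ∀ {S} r → allowed r → Side r → S ≅ concl r → I S → Any I (prems r)

backwardClosed-mono : ∀ {A B I} → (∀ {r} → A r → B r) →
                      BackwardClosed B I → BackwardClosed A I
backwardClosed-mono A⇒B closed r = closed r ∘ A⇒B

backwardClosed⇒¬GProof : ∀ {ok I} → BackwardClosed (GTPDL ok) I →
                         ∀ {S} → I S → ¬ GProof ok S
backwardClosed⇒¬GProof {ok} {I} closed = refute
  where
  mutual
    refute : ∀ {S} → I S → ¬ GProof ok S
    refute i (by r g o s e ds) = refuteSome (closed r (g , o) s e i) ds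

    refuteSome : ∀ {Ss} → Any I Ss → ¬ All (GProof ok) Ss
    refuteSome (here i)  (d ∷ _)  = refute i d
    refuteSome (there x) (_ ∷ ds) = refuteSome x ds

module _ {ok : Rule → Set} where

  Subtree : Set
  Subtree = Σ Seq (PTree ok)

  mutual
    subtreeAt : ∀ {S} → PTree ok S → Addr → Maybe Subtree
    subtreeAt t                    []      = just (_ , t)
    subtreeAt (bud _)              (_ ∷ _) = nothing
    subtreeAt (node _ _ _ _ _ ts)  (j ∷ a) = subtreeAtAll ts j a

    subtreeAtAll : ∀ {Ss} → All (PTree ok) Ss → ℕ → Addr → Maybe Subtree
    subtreeAtAll []       _       _ = nothing
    subtreeAtAll (t ∷ _)  zero    a = subtreeAt t a
    subtreeAtAll (_ ∷ ts) (suc j) a = subtreeAtAll ts j a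

  rootInfo : Subtree → Info
  rootInfo (S , bud _)              = budI S
  rootInfo (S , node r _ _ _ _ _)   = innerI S r

  mutual
    infoAt≡rootInfo : ∀ {S} (t : PTree ok S) a → infoAt t a ≡ Maybe.map rootInfo (subtreeAt t a)
    infoAt≡rootInfo (bud _)             []      = refl
    infoAt≡rootInfo (node _ _ _ _ _ _)  []      = refl
    infoAt≡rootInfo (bud _)             (_ ∷ _) = refl
    infoAt≡rootInfo (node _ _ _ _ _ ts) (j ∷ a) = infoAll≡rootInfo ts j a

    infoAll≡rootInfo : ∀ {Ss} (ts : All (PTree ok) Ss) j a →
                       infoAll ts j a ≡ Maybe.map rootInfo (subtreeAtAll ts j a)
    infoAll≡rootInfo []       _       _ = refl
    infoAll≡rootInfo (t ∷ _)  zero    a = infoAt≡rootInfo t a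
    infoAll≡rootInfo (_ ∷ ts) (suc j) a = infoAll≡rootInfo ts j a

  child : Subtree → ℕ → Maybe Subtree
  child (_ , bud _)             _ = nothing
  child (_ , node _ _ _ _ _ ts) j = subtreeAtAll ts j []

  mutual
    subtreeAt-∷ʳ : ∀ {S} (t : PTree ok S) a j {n} → subtreeAt t a ≡ just n →
                   subtreeAt t (a ∷ʳ j) ≡ child n j
    subtreeAt-∷ʳ (bud _)             []      j refl = refl
    subtreeAt-∷ʳ (node _ _ _ _ _ _)  []      j refl = refl
    subtreeAt-∷ʳ (node _ _ _ _ _ ts) (k ∷ a) j e    = subtreeAtAll-∷ʳ ts k a j e

    subtreeAtAll-∷ʳ : ∀ {Ss} (ts : All (PTree ok) Ss) k a j {n} → subtreeAtAll ts k a ≡ just n →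
                      subtreeAtAll ts k (a ∷ʳ j) ≡ child n j
    subtreeAtAll-∷ʳ (t ∷ _)  zero    a j e = subtreeAt-∷ʳ t a j e
    subtreeAtAll-∷ʳ (_ ∷ ts) (suc k) a j e = subtreeAtAll-∷ʳ ts k a j e

progress⇒cs : ∀ r j {τ τ'} → Progress r j τ τ' →
              ∃ λ Γ → ∃ λ Δ → ∃ λ π → ∃ λ φ → r ≡ cs Γ Δ π φ
progress⇒cs (cs Γ Δ π φ) (suc zero) _ = Γ , Δ , π , φ , refl
progress⇒cs (cs _ _ _ _) zero          ()
progress⇒cs (cs _ _ _ _) (suc (suc _)) ()
progress⇒cs (ax _ _)          _ ()
progress⇒cs (botL _ _)        _ ()
progress⇒cs (impL _ _ _ _)    _ ()
progress⇒cs (impR _ _ _ _)    _ ()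
progress⇒cs (wk _ _ _ _)      _ ()
progress⇒cs (cut _ _ _)       _ ()
progress⇒cs (boxR _ _ _ _)    _ ()
progress⇒cs (bboxR _ _ _ _)   _ ()
progress⇒cs (seqL _ _ _ _ _)  _ ()
progress⇒cs (seqR _ _ _ _ _)  _ ()
progress⇒cs (cupL _ _ _ _ _)  _ ()
progress⇒cs (cupR _ _ _ _ _)  _ ()
progress⇒cs (starL _ _ _ _)   _ ()
progress⇒cs (testL _ _ _ _)   _ ()
progress⇒cs (testR _ _ _ _)   _ ()
progress⇒cs (starR _ _ _)     _ ()

module RefuteCProof {ok : Rule → Set} {I : Seq → Set}
  (I-resp-≅ : ∀ {S S'} → S ≅ S' → I S → I S')
  (closed : BackwardClosed (CGTPDL ok) I)
  (¬cs : ∀ {S Γ Δ π φ} → I S → ¬ S ≅ concl (cs Γ Δ π φ))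
  {S₀ : Seq} (P : PreProof ok S₀) where

  record Visit : Set where
    field
      addr     : Addr
      sequent  : Seq
      rule     : Rule
      inC      : InCGTPDL rule
      okRule   : ok rule
      side     : Side rule
      isConcl  : sequent ≅ concl rule
      premises : All (PTree ok) (prems rule)
      located  : subtreeAt (tree P) addr ≡ just (sequent , node rule inC okRule side isConcl premises)
      inI      : I sequent
  open Visit

  infoAt-visit : (x : Visit) → infoAt (tree P) (addr x) ≡ just (innerI (sequent x) (rule x))
  infoAt-visit x = trans (infoAt≡rootInfo (tree P) (addr x)) (cong (Maybe.map rootInfo) (located x))

  visitAt : ∀ b {B r} → infoAt (tree P) b ≡ just (innerI B r) → I B → Σ Visit λ x → addr x ≡ b
  visitAt b {B} eq i with subtreeAt (tree P) b in at | trans (sym eq) (infoAt≡rootInfo (tree P) b)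
  ... | just (_ , node r iC o s c ts) | refl =
    record { addr = b ; sequent = B ; rule = r ; inC = iC ; okRule = o ; side = s
           ; isConcl = c ; premises = ts ; located = at ; inI = i } , refl

  premiseIn : ∀ {Ss} (ts : All (PTree ok) Ss) → Any I Ss →
              Σ ℕ λ j → Σ Subtree λ n → I (proj₁ n) × subtreeAtAll ts j [] ≡ just n
  premiseIn (t ∷ _)  (here i)  = 0 , (_ , t) , i , refl
  premiseIn (_ ∷ ts) (there x) with premiseIn ts x
  ... | j , n , i , at = suc j , n , i , at

  next : (x : Visit) → Σ ℕ λ j → Σ Visit λ y → Edge P (addr x) j (addr y)
  next x with premiseIn (premises x) (closed (rule x) (inC x , okRule x) (side x) (isConcl x) (inI x))
  ... | j , (Q , t) , iQ , at = j , descend t (trans (subtreeAt-∷ʳ (tree P) (addr x) j (located x)) at)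
    where
    x-inner : Σ Seq λ S → Σ Rule λ r → infoAt (tree P) (addr x) ≡ just (innerI S r)
    x-inner = sequent x , rule x , infoAt-visit x

    infoAt-child : ∀ {t} → subtreeAt (tree P) (addr x ∷ʳ j) ≡ just (Q , t) →
                   infoAt (tree P) (addr x ∷ʳ j) ≡ just (rootInfo (Q , t))
    infoAt-child at' = trans (infoAt≡rootInfo (tree P) _) (cong (Maybe.map rootInfo) at')

    descend : (t : PTree ok Q) → subtreeAt (tree P) (addr x ∷ʳ j) ≡ just (Q , t) →
              Σ Visit λ y → Edge P (addr x) j (addr y)
    descend (node r iC o s c ts) at' =
      record { addr = addr x ∷ʳ j ; sequent = Q ; rule = r ; inC = iC ; okRule = o ; side = s
             ; isConcl = c ; premises = ts ; located = at' ; inI = iQ }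
      , x-inner , inj₂ (Q , r , infoAt-child at' , refl)
    descend (bud _) at' with compOK P (addr x ∷ʳ j) Q (infoAt-child at')
    ... | B , _ , atComp , Q≅B with visitAt (comp P (addr x ∷ʳ j)) atComp (I-resp-≅ Q≅B iQ)
    ... | y , refl = y , x-inner , inj₁ (Q , infoAt-child at' , refl)

  rootVisit : I S₀ → Visit
  rootVisit i = fromRoot (tree P) refl
    where
    bud-¬inner : ∀ {S B r} a → ¬ infoAt (bud S) a ≡ just (innerI B r)
    bud-¬inner []      ()
    bud-¬inner (_ ∷ _) ()

    fromRoot : (t : PTree ok S₀) → t ≡ tree P → Visit
    fromRoot (bud _) eq with compOK P [] S₀ (cong (λ t → infoAt t []) (sym eq))
    ... | _ , _ , atComp , _ = ⊥-elim (bud-¬inner (comp P []) (trans (cong (λ t → infoAt t (comp P [])) eq) atComp))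
    fromRoot (node _ _ _ _ _ _) eq = proj₁ (visitAt [] (cong (λ t → infoAt t []) (sym eq)) i)

  visits : I S₀ → ℕ → Visit
  visits i zero    = rootVisit i
  visits i (suc k) = proj₁ (proj₂ (next (visits i k)))

  path : I S₀ → InfPath P
  path i = record
    { v    = addr ∘ visits i
    ; js   = proj₁ ∘ next ∘ visits i
    ; edge = proj₂ ∘ proj₂ ∘ next ∘ visits i
    }

  ¬progress : (x : Visit) → ∀ j {τ τ'} → ¬ Progress (rule x) j τ τ'
  ¬progress x j pr with progress⇒cs (rule x) j pr
  ... | _ , _ , _ , _ , isCs = ¬cs (inI x) (subst (λ r → sequent x ≅ concl r) isCs (isConcl x))

  ¬IsCProof : I S₀ → ¬ IsCProof P
  ¬IsCProof i isC with isC (path i)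
  ... | k , trace with ProgressingTrace.prog trace 0
  ... | m , _ , _ , _ , atₘ , pr with trans (sym atₘ) (infoAt-visit (visits i (k + m)))
  ... | refl = ¬progress (visits i (k + m)) _ pr

backwardClosed⇒¬CProvable : ∀ {ok I} → (∀ {S S'} → S ≅ S' → I S → I S') →
                            BackwardClosed (CGTPDL ok) I →
                            (∀ {S Γ Δ π φ} → I S → ¬ S ≅ concl (cs Γ Δ π φ)) →
                            ∀ {S} → I S → ¬ CProvable ok S
backwardClosed⇒¬CProvable I-resp-≅ closed ¬cs i (P , isC) =
  RefuteCProof.¬IsCProof I-resp-≅ closed ¬cs P i isC

Confined : (Fml → Set) → (Fml → Set) → Seq → Set
Confined L R S = All L (ante S) × All R (succ S)

≈set⇒⊆ : ∀ {xs ys} → xs ≈set ys → ∀ {x} → x ∈ ys → x ∈ xs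
≈set⇒⊆ eq {x} = proj₂ (eq x)

confined-resp-≅ : ∀ {L R S S'} → S ≅ S' → Confined L R S → Confined L R S'
confined-resp-≅ (ea , es) (ls , rs) = anti-mono (≈set⇒⊆ ea) ls , anti-mono (≈set⇒⊆ es) rs

module Regions {W : Set} (Left Right : W → Fml → Set) where

  InRegion : Seq → Set
  InRegion S = ∃ λ w → Confined (Left w) (Right w) S

  inRegion-resp-≅ : ∀ {S S'} → S ≅ S' → InRegion S → InRegion S'
  inRegion-resp-≅ e (w , c) = w , confined-resp-≅ e c

  ClosedAtConclusions : (Rule → Set) → Set
  ClosedAtConclusions allowed =
    ∀ r → allowed r → Side r → ∀ w → Confined (Left w) (Right w) (concl r) → Any InRegion (prems r)

  regionsClosed : ∀ {allowed} → ClosedAtConclusions allowed → BackwardClosed allowed InRegion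
  regionsClosed step r o s e (w , c) = step r o s w (confined-resp-≅ e c)

module Seq₁ (p a : ℕ) where

  α α* : Prog
  α  = atom a
  α* = star α

  seq₁-derivation : Derivation (CGTPDL CutFree) (seq₁ p a)
  seq₁-derivation =
    by (cs Γ [] α (var p)) (tt , tt) tt ≅-refl
      ( by (ax Γ [ var p ]) (tt , tt) (var p , here refl , here refl) ≅-refl []
      ∷ by (ax Γ [ box α (box α* (var p)) ]) (tt , tt) (_ , there (here refl) , here refl) ≅-refl []
      ∷ [])
    where
    Γ : List Fml
    Γ = var p ∷ box α (box α* (var p)) ∷ []

  data World : Set where
    initial afterStarR unboxed : World

  data Left : World → Fml → Set where
    var-p      : Left initial (var p)
    [α][α*]p   : Left initial (box α (box α* (var p)))
    var-p′     : Left afterStarR (var p)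

  data Right : World → Fml → Set where
    [α*]p  : Right initial (box α* (var p))
    [α]p   : Right afterStarR (box α (var p))
    var-p  : Right unboxed (var p)
    [α]_   : ∀ {φ} → Right unboxed φ → Right unboxed (box α φ)
    [α*]_  : ∀ {φ} → Right unboxed φ → Right unboxed (box α* φ)
    ←[α]_  : ∀ {φ} → Right unboxed φ → Right unboxed (bbox α φ)
    ←[α*]_ : ∀ {φ} → Right unboxed φ → Right unboxed (bbox α* φ)

  open Regions Left Right

  disjoint : ∀ {w φ} → Left w φ → ¬ Right w φ
  disjoint var-p    ()
  disjoint [α][α*]p ()
  disjoint var-p′   ()

  Decided : World → Fml → Set
  Decided w φ = Left w φ ⊎ Right w φ

  unboxed-FL : ∀ {φ} → Right unboxed φ → All (Right unboxed) (FL φ)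
  unboxed-FL var-p      = var-p ∷ []
  unboxed-FL ([α] r)    = [α] r ∷ unboxed-FL r
  unboxed-FL ([α*] r)   = [α*] r ∷ [α] [α*] r ∷ unboxed-FL r
  unboxed-FL (←[α] r)   = ←[α] r ∷ unboxed-FL r
  unboxed-FL (←[α*] r)  = ←[α*] r ∷ ←[α] ←[α*] r ∷ unboxed-FL r

  decided-FL : ∀ {w φ} → Decided w φ → All (Decided w) (FL φ)
  decided-FL {unboxed} (inj₁ ())
  decided-FL (inj₁ var-p)    = inj₁ var-p ∷ []
  decided-FL (inj₁ [α][α*]p) = inj₁ [α][α*]p ∷ inj₂ [α*]p ∷ inj₁ [α][α*]p ∷ inj₁ var-p ∷ []
  decided-FL (inj₁ var-p′)   = inj₁ var-p′ ∷ []
  decided-FL (inj₂ [α*]p)    = inj₂ [α*]p ∷ inj₁ [α][α*]p ∷ inj₁ var-p ∷ []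
  decided-FL (inj₂ [α]p)     = inj₂ [α]p ∷ inj₁ var-p′ ∷ []
  decided-FL {unboxed} (inj₂ r) = All.map inj₂ (unboxed-FL r)

  decided-FLs : ∀ {w} Λ → All (Decided w) Λ → All (Decided w) (FLs Λ)
  decided-FLs []      []       = []
  decided-FLs (_ ∷ Λ) (d ∷ ds) = ++⁺ (decided-FL d) (decided-FLs Λ ds)

  module _ {ok : Rule → Set} (onlyFLCuts : OnlyFLCuts ok) where

    step : ClosedAtConclusions (GTPDL ok)
    step (ax _ _)         _ (_ , m₁ , m₂) _ (ls , rs) = ⊥-elim (disjoint (lookup ls m₁) (lookup rs m₂))
    step (botL _ _)       _ _ _ (() ∷ _ , _)
    step (impL _ _ _ _)   _ _ _ (() ∷ _ , _)
    step (impR _ _ _ _)   _ _ _ (_ , () ∷ _)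
    step (wk _ _ _ _)     _ (Γ⊆ , Δ⊆) w (ls , rs) = here (w , anti-mono Γ⊆ ls , anti-mono Δ⊆ rs)
    step (cut Γ Δ φ)      (_ , o) _ w (ls , rs)
      with lookup (decided-FLs (Γ ++ Δ) (++⁺ (All.map inj₁ ls) (All.map inj₂ rs))) (onlyFLCuts o)
    ... | inj₁ l = there (here (w , l ∷ ls , rs))
    ... | inj₂ r = here (w , ls , r ∷ rs)
    step (boxR _ _ _ _)   _ _ _ (ls , [α*]p ∷ rs) =
      here (unboxed , All.map (λ ()) (map⁻ ls) , var-p ∷ map⁺ (All.map (λ { [α*]p → ←[α*] [α*] var-p }) rs))
    step (boxR _ _ _ _)   _ _ _ (ls , [α]p ∷ rs) =
      here (unboxed , All.map (λ ()) (map⁻ ls) , var-p ∷ map⁺ (All.map (λ { [α]p → ←[α] [α] var-p }) rs))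
    step (boxR _ _ _ _)   _ _ _ (ls , [α] r ∷ rs) =
      here (unboxed , All.map (λ ()) (map⁻ ls) , r ∷ map⁺ (All.map ←[α]_ rs))
    step (boxR _ _ _ _)   _ _ _ (ls , [α*] r ∷ rs) =
      here (unboxed , All.map (λ ()) (map⁻ ls) , r ∷ map⁺ (All.map ←[α*]_ rs))
    step (bboxR _ _ _ _)  _ _ _ (ls , ←[α] r ∷ rs) =
      here (unboxed , All.map (λ ()) (map⁻ ls) , r ∷ map⁺ (All.map [α]_ rs))
    step (bboxR _ _ _ _)  _ _ _ (ls , ←[α*] r ∷ rs) =
      here (unboxed , All.map (λ ()) (map⁻ ls) , r ∷ map⁺ (All.map [α*]_ rs))
    step (seqL _ _ _ _ _) _ _ _ (() ∷ _ , _)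
    step (cupL _ _ _ _ _) _ _ _ (() ∷ _ , _)
    step (starL _ _ _ _)  _ _ _ (() ∷ _ , _)
    step (testL _ _ _ _)  _ _ _ (() ∷ _ , _)
    step (seqR _ _ _ _ _) _ _ _ (_ , () ∷ _)
    step (cupR _ _ _ _ _) _ _ _ (_ , () ∷ _)
    step (testR _ _ _ _)  _ _ _ (_ , () ∷ _)
    step (starR _ _ _)    _ _ _ (var-p ∷ ls , [α*]p ∷ []) =
      here (afterStarR , var-p′ ∷ All.map (λ ()) (map⁻ ls) , [α]p ∷ [])
    step (cs _ _ _ _)     (() , _)

  initialInRegion : InRegion (seq₁ p a)
  initialInRegion = initial , var-p ∷ [α][α*]p ∷ [] , [α*]p ∷ []

  seq₁-¬GProvable : ∀ {ok} → OnlyFLCuts ok → ¬ GProvable ok (seq₁ p a)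
  seq₁-¬GProvable onlyFLCuts =
    backwardClosed⇒¬GProof (regionsClosed (step onlyFLCuts)) initialInRegion

module Seq₂ (p a : ℕ) where

  α : Prog
  α = atom a

  seq₂-derivation : Derivation InBoth (seq₂ p a)
  seq₂-derivation =
    by (cut [ var p ] [ G ] (neg (var p))) (tt , tt) tt ≅-refl
      ( by (wk [] (G ∷ neg (var p) ∷ []) [ var p ] (neg (var p) ∷ G ∷ [])) (tt , tt)
           ((λ ()) , λ { (here refl) → there (here refl) ; (there (here refl)) → here refl }) ≅-refl
           ( by (boxR [] [ neg (var p) ] α (bdia α (var p))) (tt , tt) tt ≅-refl
                ( by (impR [] [ B ] B ⊥') (tt , tt) tt ≅-refl
                     ( by (ax [ B ] (⊥' ∷ [ B ])) (tt , tt) (B , here refl , there (here refl)) ≅-refl []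
                     ∷ [])
                ∷ [])
           ∷ [])
      ∷ by (impL [ var p ] [ G ] (var p) ⊥') (tt , tt) tt ≅-refl
           ( by (ax [ var p ] (var p ∷ [ G ])) (tt , tt) (var p , here refl , here refl) ≅-refl []
           ∷ by (botL [ var p ] [ G ]) (tt , tt) tt ≅-refl []
           ∷ [])
      ∷ [])
    where
    B G : Fml
    B = bbox α (neg (var p))
    G = box α (bdia α (var p))

  data World : Set where
    initial underBox underBbox : World

  data Left : World → Fml → Set where
    var-p  : Left initial (var p)
    ←[α]¬p : Left underBox (bbox α (neg (var p)))
    ¬p     : Left underBbox (neg (var p))

  data Right : World → Fml → Set where
    [α]←⟨α⟩p : Right initial (box α (bdia α (var p)))
    ←⟨α⟩p    : Right underBox (bdia α (var p))
    ⊥        : Right underBox ⊥'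
    ←[α]_    : ∀ {δ} → Right underBbox δ → Right underBox (bbox α δ)
    var-p    : Right underBbox (var p)
    [α]_     : ∀ {χ} → Right underBox χ → Right underBbox (box α χ)

  open Regions Left Right

  disjoint : ∀ {w φ} → Left w φ → ¬ Right w φ
  disjoint var-p  ()
  disjoint ←[α]¬p (←[α] ())
  disjoint ¬p     ()

  step : ClosedAtConclusions CutFree
  step (ax _ _)         _ (_ , m₁ , m₂) _ (ls , rs) = ⊥-elim (disjoint (lookup ls m₁) (lookup rs m₂))
  step (botL _ _)       _ _ _ (() ∷ _ , _)
  step (impL _ _ _ _)   _ _ _ (¬p ∷ ls , rs) = here (underBbox , ls , var-p ∷ rs)
  step (impR _ _ _ _)   _ _ _ (ls , ←⟨α⟩p ∷ rs) = here (underBox , ←[α]¬p ∷ ls , ⊥ ∷ rs)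
  step (wk _ _ _ _)     _ (Γ⊆ , Δ⊆) w (ls , rs) = here (w , anti-mono Γ⊆ ls , anti-mono Δ⊆ rs)
  step (cut _ _ _)      () _ _ _
  step (boxR _ _ _ _)   _ _ _ (ls , [α]←⟨α⟩p ∷ rs) =
    here (underBox , All.map (λ ()) (map⁻ ls) , ←⟨α⟩p ∷ map⁺ (All.map (λ { [α]←⟨α⟩p → ←[α] [α] ←⟨α⟩p }) rs))
  step (boxR _ _ _ _)   _ _ _ (ls , [α] r ∷ rs) =
    here (underBox , All.map (λ ()) (map⁻ ls) , r ∷ map⁺ (All.map ←[α]_ rs))
  step (bboxR _ _ _ _)  _ _ _ (ls , ←[α] r ∷ rs) =
    here (underBbox , All.map (λ { ←[α]¬p → ¬p }) (map⁻ ls) , r ∷ map⁺ (All.map [α]_ rs))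
  step (seqL _ _ _ _ _) _ _ _ (() ∷ _ , _)
  step (cupL _ _ _ _ _) _ _ _ (() ∷ _ , _)
  step (starL _ _ _ _)  _ _ _ (() ∷ _ , _)
  step (testL _ _ _ _)  _ _ _ (() ∷ _ , _)
  step (seqR _ _ _ _ _) _ _ _ (_ , () ∷ _)
  step (cupR _ _ _ _ _) _ _ _ (_ , () ∷ _)
  step (testR _ _ _ _)  _ _ _ (_ , () ∷ _)
  step (starR _ _ _)    _ _ _ (_ , () ∷ _)
  step (cs _ _ _ _)     _ _ _ (_ , () ∷ _)

  ¬cs : ∀ {S Γ Δ π φ} → InRegion S → ¬ S ≅ concl (cs Γ Δ π φ)
  ¬cs i e with inRegion-resp-≅ e i
  ... | _ , _ , () ∷ _

  initialInRegion : InRegion (seq₂ p a)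
  initialInRegion = initial , var-p ∷ [] , [α]←⟨α⟩p ∷ []

  closed : BackwardClosed CutFree InRegion
  closed = regionsClosed step

  seq₂-¬GProvable : ¬ GProvable CutFree (seq₂ p a)
  seq₂-¬GProvable = backwardClosed⇒¬GProof (backwardClosed-mono proj₂ closed) initialInRegion

  seq₂-¬CProvable : ¬ CProvable CutFree (seq₂ p a)
  seq₂-¬CProvable =
    backwardClosed⇒¬CProvable inRegion-resp-≅ (backwardClosed-mono proj₂ closed) ¬cs initialInRegion

mainTheorem12 : (p a : ℕ) →
    ((¬ GProvable CutFree (seq₁ p a)) × (¬ GProvable FLCut (seq₁ p a)))
    × CProvable CutFree (seq₁ p a)
    × (GProvable AnyCut (seq₂ p a) × CProvable AnyCut (seq₂ p a))
    × ((¬ GProvable CutFree (seq₂ p a)) × (¬ CProvable CutFree (seq₂ p a)))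
mainTheorem12 p a =
  ( (seq₁-¬GProvable (λ ()) , seq₁-¬GProvable id)
  , derivation⇒CProvable id seq₁-derivation
  , ( derivation⇒GProof (λ (g , _) → g , tt) seq₂-derivation
    , derivation⇒CProvable (λ (_ , c) → c , tt) seq₂-derivation)
  , (seq₂-¬GProvable , seq₂-¬CProvable))
  where
  open Seq₁ p a using (seq₁-derivation; seq₁-¬GProvable)
  open Seq₂ p a using (seq₂-derivation; seq₂-¬GProvable; seq₂-¬CProvable)
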